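{- Every exact red graph of a non-elliptic web has a cycle.
   Context: Webs are planar bipartite trivalent-internal-vertex graphs in a disk with edges oriented/colored (black/white vertices); non-elliptic means no multiple edges and no internal cycles of length $\le4$. A red graph for a web $W$ is a non-empty induced subgraph $G$ of the dual graph of $W$ whose vertices correspond to some interior faces of $W$ diffeomorphic to discs, such that whenever three faces of $W$ share a vertex, at least one of them is not a vertex of $G$. For a vertex $f$ of $G$, the external degree $\mathrm{ed}(f)$ is the number of half-edges of $W$ adjacent to $f$ (gray half-edges) that do not bound $f$ or another vertex of $G$. The level of $G$ is $I(G)=2|V(G)|-|E(G)|-\frac12\sum_{f\in V(G)}\mathrm{ed}(f)$; $G$ is exact if $I(G)=0$. (A red graph is admissible if it has an orientation $o$ with $i_o(f)=2-\frac12\mathrm{ed}(f)-|\{\text{edges of }G\text{ pointing to }f\}|\ge0$ for all $f$.) -}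

module Defs where

open import Data.Nat using (ℕ; zero; suc; _+_; _*_; _≤_; _<_; _≤?_; _<?_)
open import Data.Fin using (Fin; toℕ) renaming (zero to fzero; suc to fsuc)
open import Data.Fin.Properties using (_≟_)
open import Data.Bool using (Bool; true; false)
import Data.Bool.Properties as BoolP
open import Data.List using (List; length; filter; upTo; map; allFin)
open import Data.Nat.ListAction using (sum)
open import Data.List.Relation.Unary.All using (All; all?)
open import Data.List.Relation.Unary.Any using (Any; any?)
open import Data.Product using (Σ; ∃; _×_; _,_)
open import Data.Sum using (_⊎_)
open import Data.Empty using (⊥)
open import Data.Integer using (ℤ; +_; _-_)
open import Data.Rational.Unnormalised using (ℚᵘ; _/_; _≃_; 0ℚᵘ)
open import Relation.Nullary using (¬_; Dec)
open import Relation.Nullary.Decidable using (_×-dec_)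
open import Relation.Unary using (Decidable)
open import Relation.Binary.PropositionalEquality using (_≡_; _≢_)

iter : ∀ {A : Set} → (A → A) → ℕ → A → A
iter f zero x = x
iter f (suc k) x = f (iter f k x)

count : ∀ {n} (P : Fin n → Set) → Decidable P → ℕ
count {n} P P? = length (filter P? (allFin n))

-- cyclic successor i ↦ i+1 mod (m+1)
cyc : ∀ {m} → Fin (suc m) → Fin (suc m)
cyc {zero} fzero = fzero
cyc {suc m} fzero = fsuc fzero
cyc {suc m} (fsuc i) with cyc {m} i
... | fzero = fzero
... | fsuc j = fsuc (fsuc j)

b2n : Bool → ℕ
b2n true = 1
b2n false = 0

module Orbits {n : ℕ} (π : Fin n → Fin n) where
  -- y lies in the π-orbit of x (an orbit has at most n elements)
  SameOrbit : Fin n → Fin n → Set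
  SameOrbit x y = Any (λ k → iter π k x ≡ y) (upTo n)

  sameOrbit? : ∀ x → Decidable (SameOrbit x)
  sameOrbit? x y = any? (λ k → iter π k x ≟ y) (upTo n)

  IsRep : Fin n → Set
  IsRep x = All (λ k → toℕ x ≤ toℕ (iter π k x)) (upTo n)

  isRep? : Decidable IsRep
  isRep? x = all? (λ k → toℕ x ≤? toℕ (iter π k x)) (upTo n)

  orbitCount : ℕ
  orbitCount = count IsRep isRep?

data Reach {n : ℕ} (α σ : Fin n → Fin n) (x : Fin n) : Fin n → Set where
  here : Reach α σ x x
  viaα : ∀ {y} → Reach α σ x y → Reach α σ x (α y)
  viaσ : ∀ {y} → Reach α σ x y → Reach α σ x (σ y)

-- Webs, encoded as combinatorial maps (rotation systems).
--
-- Darts (half-edges) are Fin n.  α pairs the two darts of an edge,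
-- σ rotates (counterclockwise) around a vertex; vertices = σ-orbits,
-- faces = orbits of φ = σ ∘ α.  The boundary circle of the disc is
-- added to the map: its edges are the darts with circ d ≡ true, and the
-- boundary points of the web are the vertices carrying circle darts.
-- Every vertex then has exactly three darts: internal (trivalent) web
-- vertices carry 0 circle darts, boundary vertices carry 2 circle darts
-- and 1 web dart.  The face of dart d is the face at the corner between
-- σ⁻¹ d and d; the two sides of the edge {d , α d} are the faces of d
-- and of α d.

record Web : Set where
  field
    n      : ℕ
    α      : Fin n → Fin n
    σ      : Fin n → Fin n
    circ   : Fin n → Bool
    colour : Fin n → Bool   -- black/white colour of the vertex of a dart
    α-invol : ∀ d → α (α d) ≡ d
    α-free  : ∀ d → α d ≢ d
    σ-cube  : ∀ d → σ (σ (σ d)) ≡ d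
    σ-free  : ∀ d → σ d ≢ d
    circ-α  : ∀ d → circ (α d) ≡ circ d
    vertex-type : ∀ d → (b2n (circ d) + b2n (circ (σ d)) + b2n (circ (σ (σ d))) ≡ 0)
                      ⊎ (b2n (circ d) + b2n (circ (σ d)) + b2n (circ (σ (σ d))) ≡ 2)
    colour-σ : ∀ d → colour (σ d) ≡ colour d
    colour-α : ∀ d → circ d ≡ false → colour (α d) ≢ colour d
    -- connected planar (genus 0) map: V - E + F = 2
    connected : ∀ d d' → Reach α σ d d'
    euler : Orbits.orbitCount σ + Orbits.orbitCount (λ d → σ (α d))
            ≡ count (λ d → toℕ d < toℕ (α d)) (λ d → toℕ d <? toℕ (α d)) + 2
    -- the boundary circle is a single cycle bounding the outer face
    outer : Σ (Fin n) λ o →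
              (∀ d → Orbits.SameOrbit (λ x → σ (α x)) o d → circ d ≡ true)
            × (∀ d → circ d ≡ true →
                 Orbits.SameOrbit (λ x → σ (α x)) o d
                 ⊎ Orbits.SameOrbit (λ x → σ (α x)) o (α d))

module _ (W : Web) where
  open Web W

  φ : Fin n → Fin n
  φ d = σ (α d)

  SameFace : Fin n → Fin n → Set
  SameFace = Orbits.SameOrbit φ

  SameVertex : Fin n → Fin n → Set
  SameVertex = Orbits.SameOrbit σ

  -- A cycle of length m+1 in the web graph (boundary circle excluded):
  -- web darts d i leaving pairwise distinct vertices, α (d i) at the
  -- vertex of d (i+1), and pairwise distinct edges.
  WebCycle : ℕ → Set
  WebCycle m = Σ (Fin (suc m) → Fin n) λ d →
      (∀ i → circ (d i) ≡ false)
    × (∀ i → SameVertex (α (d i)) (d (cyc i)))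
    × (∀ i j → i ≢ j → ¬ SameVertex (d i) (d j))
    × (∀ i j → i ≢ j → (d j ≢ d i) × (d j ≢ α (d i)))

  -- no multiple edges and no cycles of length ≤ 4
  NonElliptic : Set
  NonElliptic = ∀ m → m < 4 → ¬ WebCycle m

  -- A red graph: a set of interior faces (φ-orbits containing no circle
  -- dart), given by a φ-invariant indicator on darts.
  record RedGraph : Set where
    field
      inG : Fin n → Bool
      inG-face     : ∀ d → inG (φ d) ≡ inG d
      inG-interior : ∀ d → inG d ≡ true → circ d ≡ false
      nonempty     : ∃ λ d → inG d ≡ true
      -- the three faces around a vertex are not all in G
      no-triple    : ∀ d → inG d ≡ true → inG (σ d) ≡ true
                         → inG (σ (σ d)) ≡ true → ⊥

  module _ (G : RedGraph) where
    open RedGraph G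

    In : Fin n → Set
    In d = inG d ≡ true

    in? : Decidable In
    in? d = inG d BoolP.≟ true

    -- faces of G, represented by their least dart
    IsVertexG : Fin n → Set
    IsVertexG d = In d × Orbits.IsRep φ d

    isVertexG? : Decidable IsVertexG
    isVertexG? d = in? d ×-dec Orbits.isRep? φ d

    numV : ℕ
    numV = count IsVertexG isVertexG?

    -- edges {d , α d} (represented by the smaller dart) with both sides in G
    IsEdgeG : Fin n → Set
    IsEdgeG d = In d × In (α d) × toℕ d < toℕ (α d)

    isEdgeG? : Decidable IsEdgeG
    isEdgeG? d = in? d ×-dec (in? (α d) ×-dec (toℕ d <? toℕ (α d)))

    numE : ℕ
    numE = count IsEdgeG isEdgeG?

    -- the half-edge σ d sticking out of the corner d of a face is gray
    -- iff the two faces it bounds (those of σ d and σ (σ d)) are not in G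
    Gray : Fin n → Set
    Gray d = inG (σ d) ≡ false × inG (σ (σ d)) ≡ false

    gray? : Decidable Gray
    gray? d = (inG (σ d) BoolP.≟ false) ×-dec (inG (σ (σ d)) BoolP.≟ false)

    ed : Fin n → ℕ
    ed f = count (λ d → SameFace f d × Gray d)
                 (λ d → Orbits.sameOrbit? φ f d ×-dec gray? d)

    sumEd : ℕ
    sumEd = sum (map ed (filter isVertexG? (allFin n)))

    -- I(G) = 2|V| - |E| - ½ Σ ed  =  (4|V| - 2|E| - Σ ed) / 2
    level : ℚᵘ
    level = ((+ (4 * numV) - + (2 * numE)) - + sumEd) / 2

    Exact : Set
    Exact = level ≃ 0ℚᵘ

    -- a cycle (of length m+1) in the multigraph G: dual edges e i
    -- crossing web edges {e i , α (e i)}, from the face of e i to the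
    -- face of α (e i) = face of e (i+1); faces pairwise distinct,
    -- edges pairwise distinct.
    HasCycle : Set
    HasCycle = Σ ℕ λ m → Σ (Fin (suc m) → Fin n) λ e →
        (∀ i → In (e i))
      × (∀ i → SameFace (α (e i)) (e (cyc i)))
      × (∀ i j → i ≢ j → ¬ SameFace (e i) (e j))
      × (∀ i j → i ≢ j → (e j ≢ e i) × (e j ≢ α (e i)))

module Submission where

-- Every dart lying in a face of G is either gray, or shares its
-- web edge with another face of G on its left or on its right (never both,
-- since three faces around a vertex are never all in G).  Summing over the
-- faces of G this gives  Σ_f |f| = Σ ed + 4|E|.  Non-ellipticity forces every
-- interior face to have at least 6 sides (2 and 4 sides would give cycles of
-- length 2 or 4 in the web, odd lengths are excluded by bipartiteness), so
-- 6|V| ≤ Σ ed + 4|E|.  Exactness says 4|V| = 2|E| + Σ ed, hence |V| ≤ |E|.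
--
-- A finite multigraph with |V| ≤ |E| and at least one edge has
-- a cycle: a loop is a cycle; a vertex of degree ≤ 1 can be removed keeping
-- |V| ≤ |E| and an edge; and if all degrees are ≥ 2 a walk that never turns
-- back along the edge it came in by eventually revisits a face, closing a cycle.

open import Defs

open import Data.Nat as ℕ
  using (ℕ; zero; suc; _+_; _*_; _≤_; _<_; z≤n; s≤s; s≤s⁻¹; _<?_)
open import Data.Nat.Properties
import Data.Nat.DivMod
open import Data.Nat.ListAction using (sum)
open import Data.Nat.Tactic.RingSolver using (solve-∀)
import Data.Integer as ℤ
import Data.Integer.Properties as ℤP
import Data.Rational.Unnormalised as ℚ
open import Data.Rational.Unnormalised using (_≃_; *≡*; 0ℚᵘ)
open import Data.Fin as F using (Fin; toℕ) renaming (zero to fzero; suc to fsuc)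
import Data.Fin.Properties as FP
open import Data.Fin.Permutation using (permutation)
open import Data.Bool using (Bool; true; false)
import Data.Bool.Properties as Bool
open import Data.Unit using (tt)
open import Data.Empty using (⊥; ⊥-elim)
open import Data.Product using (Σ; ∃; _×_; _,_; proj₁; proj₂)
open import Data.Sum using (_⊎_; inj₁; inj₂)
open import Data.List using (length; filter; tabulate; map)
open import Data.List.Membership.Propositional using (lose)
open import Data.List.Membership.Propositional.Properties using (∈-upTo⁺)
open import Data.List.Relation.Unary.Any using (satisfied)
import Data.List.Relation.Unary.All as All
open import Algebra.Properties.Semiring.Sum +-*-semiring
  using (∑-distrib-+; ∑-comm; ∑-permute; sum-cong-≗; *-distribˡ-sum)
  renaming (sum to ∑)
open import Function using (_∘_)
open import Relation.Nullary using (¬_; Dec; yes; no; ¬?)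
open import Relation.Nullary.Decidable using (_×-dec_)
open import Relation.Unary using (Decidable)
open import Relation.Binary.Definitions using (tri<; tri≈; tri>)
open import Relation.Binary.PropositionalEquality hiding (J)

-- Counting with indicator sums.  A count over Fin n is rewritten as a sum of
-- indicators, ∑ (λ i → ind (P? i)), so that counts can be split, compared and
-- reindexed pointwise.

ind : ∀ {P : Set} → Dec P → ℕ
ind (yes _) = 1
ind (no _) = 0

count≡∑ : ∀ {m n} {P : Fin n → Set} (P? : Decidable P) (f : Fin m → Fin n) →
          length (filter P? (tabulate f)) ≡ ∑ (λ i → ind (P? (f i)))
count≡∑ {zero} P? f = refl
count≡∑ {suc m} P? f with P? (f fzero)
... | yes _ = cong suc (count≡∑ P? (f ∘ fsuc))
... | no _ = count≡∑ P? (f ∘ fsuc)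

ind-cong : ∀ {P Q : Set} → (P → Q) → (Q → P) → (p : Dec P) (q : Dec Q) → ind p ≡ ind q
ind-cong f g (yes _) (yes _) = refl
ind-cong f g (yes x) (no ¬y) = ⊥-elim (¬y (f x))
ind-cong f g (no ¬x) (yes y) = ⊥-elim (¬x (g y))
ind-cong f g (no _) (no _) = refl

ind-× : ∀ {P Q : Set} (p : Dec P) (q : Dec Q) → ind (p ×-dec q) ≡ ind p * ind q
ind-× (yes _) (yes _) = refl
ind-× (yes _) (no _) = refl
ind-× (no _) (yes _) = refl
ind-× (no _) (no _) = refl

ind-true : ∀ {P : Set} (p : Dec P) → P → ind p ≡ 1
ind-true (yes _) _ = refl
ind-true (no ¬x) x = ⊥-elim (¬x x)

ind-false : ∀ {P : Set} (p : Dec P) → ¬ P → ind p ≡ 0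
ind-false (yes x) ¬x = ⊥-elim (¬x x)
ind-false (no _) _ = refl

ind-witness : ∀ {P : Set} (p : Dec P) → 1 ≤ ind p → P
ind-witness (yes x) _ = x
ind-witness (no _) ()

ind-split : ∀ {P Q : Set} (p : Dec P) (q : Dec Q) →
            ind p ≡ ind (p ×-dec q) + ind (p ×-dec (¬? q))
ind-split (yes _) (yes _) = refl
ind-split (yes _) (no _) = refl
ind-split (no _) (yes _) = refl
ind-split (no _) (no _) = refl

ind-cover₃ : ∀ {P Q R T : Set} (p : Dec P) (q : Dec Q) (r : Dec R) (t : Dec T) →
             (P → Q ⊎ R ⊎ T) → ind p ≤ ind q + (ind r + ind t)
ind-cover₃ (no _) q r t h = z≤n
ind-cover₃ {Q = Q} {R} {T} (yes x) q r t h = cover (h x)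
  where
  cover : Q ⊎ R ⊎ T → 1 ≤ ind q + (ind r + ind t)
  cover (inj₁ y) = ≤-trans (≤-reflexive (sym (ind-true q y))) (m≤m+n _ _)
  cover (inj₂ (inj₁ y)) =
    ≤-trans (≤-reflexive (sym (ind-true r y))) (≤-trans (m≤m+n _ _) (m≤n+m _ (ind q)))
  cover (inj₂ (inj₂ y)) =
    ≤-trans (≤-reflexive (sym (ind-true t y))) (≤-trans (m≤n+m _ (ind r)) (m≤n+m _ (ind q)))

ind-disjoint : ∀ {P Q R : Set} (p : Dec P) (q : Dec Q) (r : Dec R) →
               (Q → R → ⊥) → (Q → P) → (R → P) → ind q + ind r ≤ ind p
ind-disjoint p (yes x) (yes y) d f g = ⊥-elim (d x y)
ind-disjoint p (yes x) (no _) d f g = ≤-reflexive (sym (ind-true p (f x)))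
ind-disjoint p (no _) (yes y) d f g = ≤-reflexive (sym (ind-true p (g y)))
ind-disjoint p (no _) (no _) d f g = z≤n

∑-mono : ∀ {n} {f g : Fin n → ℕ} → (∀ i → f i ≤ g i) → ∑ f ≤ ∑ g
∑-mono {zero} e = z≤n
∑-mono {suc n} e = +-mono-≤ (e fzero) (∑-mono (e ∘ fsuc))

∑-term≤ : ∀ {n} (f : Fin n → ℕ) (a : Fin n) → f a ≤ ∑ f
∑-term≤ {suc n} f fzero = m≤m+n (f fzero) _
∑-term≤ {suc n} f (fsuc a) = ≤-trans (∑-term≤ (f ∘ fsuc) a) (m≤n+m _ (f fzero))

∑-positive : ∀ {n} (f : Fin n → ℕ) → 1 ≤ ∑ f → ∃ λ i → 1 ≤ f i
∑-positive {suc n} f h with f fzero in eq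
... | suc _ = fzero , subst (1 ≤_) (sym eq) (s≤s z≤n)
... | zero with ∑-positive (f ∘ fsuc) h
...   | i , p = fsuc i , p

∑-point : ∀ {n} (a : Fin n) → ∑ (λ i → ind (i FP.≟ a)) ≡ 1
∑-point {suc n} fzero = cong suc (∑-zero {n} (λ i → ind-false (fsuc i FP.≟ fzero) (λ ())))
  where
  ∑-zero : ∀ {k} {f : Fin k → ℕ} → (∀ i → f i ≡ 0) → ∑ f ≡ 0
  ∑-zero {zero} e = refl
  ∑-zero {suc k} e = cong₂ _+_ (e fzero) (∑-zero (e ∘ fsuc))
∑-point {suc n} (fsuc a) =
  trans (cong₂ _+_ (ind-false (fzero FP.≟ fsuc a) (λ ())) (sum-cong-≗ {n} shift)) (∑-point a)
  where
  shift : ∀ i → ind (fsuc i FP.≟ fsuc a) ≡ ind (i FP.≟ a)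
  shift i = ind-cong FP.suc-injective (cong fsuc) (fsuc i FP.≟ fsuc a) (i FP.≟ a)

count-remove : ∀ {n} {P : Fin n → Set} (P? : Decidable P) (a : Fin n) → P a →
               ∑ (λ i → ind (P? i)) ≡ suc (∑ (λ i → ind (P? i ×-dec (¬? (i FP.≟ a)))))
count-remove {n} {P} P? a pa = begin
  ∑ (λ i → ind (P? i))
    ≡⟨ sum-cong-≗ (λ i → ind-split (P? i) (i FP.≟ a)) ⟩
  ∑ (λ i → ind (P? i ×-dec (i FP.≟ a)) + ind (P? i ×-dec (¬? (i FP.≟ a))))
    ≡⟨ ∑-distrib-+ (λ i → ind (P? i ×-dec (i FP.≟ a))) (λ i → ind (P? i ×-dec (¬? (i FP.≟ a)))) ⟩
  ∑ (λ i → ind (P? i ×-dec (i FP.≟ a))) + rest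
    ≡⟨ cong (_+ rest) (trans (sum-cong-≗ only-a) (∑-point a)) ⟩
  suc rest ∎
  where
  open ≡-Reasoning
  rest : ℕ
  rest = ∑ (λ i → ind (P? i ×-dec (¬? (i FP.≟ a))))
  only-a : ∀ i → ind (P? i ×-dec (i FP.≟ a)) ≡ ind (i FP.≟ a)
  only-a i = ind-cong proj₂ (λ e → subst P (sym e) pa , e) (P? i ×-dec (i FP.≟ a)) (i FP.≟ a)

two-witnesses : ∀ {n} {P : Fin n → Set} (P? : Decidable P) → 2 ≤ ∑ (λ i → ind (P? i)) →
                Σ (Fin n) λ a → Σ (Fin n) λ b → a ≢ b × P a × P b
two-witnesses P? h with ∑-positive (λ i → ind (P? i)) (≤-trans (s≤s z≤n) h)
... | a , pa with ind-witness (P? a) pa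
...   | Pa with ∑-positive _ (s≤s⁻¹ (subst (2 ≤_) (count-remove P? a Pa) h))
...     | b , pb with ind-witness (P? b ×-dec ¬? (b FP.≟ a)) pb
...       | Pb , b≢a = a , b , (λ e → b≢a (sym e)) , Pa , Pb

injective-count : ∀ {k n} {P : Fin n → Set} (P? : Decidable P) (xs : Fin k → Fin n) →
                  (∀ {i j} → xs i ≡ xs j → i ≡ j) → (∀ i → P (xs i)) →
                  k ≤ ∑ (λ y → ind (P? y))
injective-count {zero} P? xs inj ok = z≤n
injective-count {suc k} {P = P} P? xs inj ok =
  subst (suc k ≤_) (sym (count-remove P? (xs fzero) (ok fzero)))
    (s≤s (injective-count (λ y → P? y ×-dec ¬? (y FP.≟ xs fzero)) (xs ∘ fsuc)
            (λ e → FP.suc-injective (inj e))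
            (λ i → ok (fsuc i) , λ e → FP.0≢1+n (sym (inj e)))))

least-Fin : ∀ {n} {P : Fin n → Set} → Decidable P → ∀ a → P a →
            Σ (Fin n) λ y → P y × (∀ z → P z → toℕ y ≤ toℕ z)
least-Fin {suc n} {P} P? a pa with P? fzero
... | yes p0 = fzero , p0 , (λ z _ → z≤n)
... | no ¬p0 with a
...   | fzero = ⊥-elim (¬p0 pa)
...   | fsuc a' with least-Fin (P? ∘ fsuc) a' pa
...     | y , py , least = fsuc y , py , least′
  where
  least′ : ∀ z → P z → toℕ (fsuc y) ≤ toℕ z
  least′ fzero pz = ⊥-elim (¬p0 pz)
  least′ (fsuc z) pz = s≤s (least z pz)

least-ℕ : ∀ {P : ℕ → Set} → Decidable P → ∀ k → P k →
          Σ ℕ λ j → P j × (∀ i → i < j → ¬ P i)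
least-ℕ {P} P? k pk
  with least-Fin {suc k} {P ∘ toℕ} (P? ∘ toℕ) (F.fromℕ k) (subst P (sym (FP.toℕ-fromℕ k)) pk)
... | y , py , least = toℕ y , py , below
  where
  below : ∀ i → i < toℕ y → ¬ P i
  below i i<y pi = <⇒≱ i<y (subst (toℕ y ≤_) (FP.toℕ-fromℕ< i<k) (least (F.fromℕ< i<k) pi′))
    where
    i<k : i < suc k
    i<k = <-≤-trans i<y (FP.toℕ≤n y)
    pi′ : P (toℕ (F.fromℕ< i<k))
    pi′ = subst P (sym (FP.toℕ-fromℕ< i<k)) pi

-- Orbits of an injective map f on Fin n (injectivity witnessed by a left
-- inverse g), i.e. of a permutation.
module Orbit {n : ℕ} (f g : Fin n → Fin n) (gf : ∀ x → g (f x) ≡ x) where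
  open Orbits f public

  iter-+ : ∀ a b x → iter f (a + b) x ≡ iter f a (iter f b x)
  iter-+ zero b x = refl
  iter-+ (suc a) b x = cong f (iter-+ a b x)

  iter-injective : ∀ k {x y} → iter f k x ≡ iter f k y → x ≡ y
  iter-injective zero e = e
  iter-injective (suc k) {x} {y} e =
    iter-injective k (trans (sym (gf _)) (trans (cong g e) (gf _)))

  iter-multiple : ∀ {p x} → iter f p x ≡ x → ∀ q → iter f (q * p) x ≡ x
  iter-multiple e zero = refl
  iter-multiple {p} {x} e (suc q) =
    trans (iter-+ p (q * p) x) (trans (cong (iter f p) (iter-multiple e q)) e)

  -- Every element returns to itself after at most n steps (pigeonhole).
  period : ∀ x → Σ ℕ λ p → suc p ≤ n × iter f (suc p) x ≡ x
  period x with FP.pigeonhole (n<1+n n) (λ (i : Fin (suc n)) → iter f (toℕ i) x)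
  ... | i , j , i<j , eq with m≤n⇒∃[o]m+o≡n i<j
  ...   | o , e = o , o<n , iter-injective (toℕ i) back
    where
    j≡ : suc o + toℕ i ≡ toℕ j
    j≡ = trans (cong suc (+-comm o (toℕ i))) e
    o<n : suc o ≤ n
    o<n = ≤-trans (m≤m+n (suc o) (toℕ i)) (≤-trans (≤-reflexive j≡) (FP.toℕ≤pred[n] j))
    back : iter f (toℕ i) (iter f (suc o) x) ≡ iter f (toℕ i) x
    back = begin
      iter f (toℕ i) (iter f (suc o) x) ≡⟨ iter-+ (toℕ i) (suc o) x ⟨
      iter f (toℕ i + suc o) x          ≡⟨ cong (λ k → iter f k x) (trans (+-comm (toℕ i) (suc o)) j≡) ⟩
      iter f (toℕ j) x                  ≡⟨ eq ⟨
      iter f (toℕ i) x                  ∎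
      where open ≡-Reasoning

  Reaches : Fin n → Fin n → Set
  Reaches x y = Σ ℕ λ k → iter f k x ≡ y

  reduce : ∀ x k → Σ ℕ λ k' → k' < n × iter f k' x ≡ iter f k x
  reduce x k with period x
  ... | p , p≤ , e = k % suc p , <-≤-trans (m%n<n k (suc p)) p≤ , same
    where
    open Data.Nat.DivMod using (_%_; _/_; m%n<n; m≡m%n+[m/n]*n)
    same : iter f (k % suc p) x ≡ iter f k x
    same = begin
      iter f (k % suc p) x                                ≡⟨ cong (iter f (k % suc p)) (iter-multiple e (k / suc p)) ⟨
      iter f (k % suc p) (iter f (k / suc p * suc p) x)   ≡⟨ iter-+ (k % suc p) _ x ⟨
      iter f (k % suc p + k / suc p * suc p) x            ≡⟨ cong (λ z → iter f z x) (m≡m%n+[m/n]*n k (suc p)) ⟨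
      iter f k x                                          ∎
      where open ≡-Reasoning

  Reaches⇒SO : ∀ {x y} → Reaches x y → SameOrbit x y
  Reaches⇒SO {x} (k , e) with reduce x k
  ... | k' , k'<n , e' = lose (∈-upTo⁺ k'<n) (trans e' e)

  SO⇒Reaches : ∀ {x y} → SameOrbit x y → Reaches x y
  SO⇒Reaches = satisfied

  SO-iter : ∀ k x → SameOrbit x (iter f k x)
  SO-iter k x = Reaches⇒SO (k , refl)

  SO-refl : ∀ {x} → SameOrbit x x
  SO-refl = SO-iter 0 _

  SO-trans : ∀ {x y z} → SameOrbit x y → SameOrbit y z → SameOrbit x z
  SO-trans s t with SO⇒Reaches s | SO⇒Reaches t
  ... | a , refl | b , refl = Reaches⇒SO (b + a , iter-+ b a _)

  -- Going back from y to x means going once more around the cycle of x.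
  SO-sym : ∀ {x y} → SameOrbit x y → SameOrbit y x
  SO-sym {x} s with SO⇒Reaches s | period x
  ... | k , refl | p , _ , ep = Reaches⇒SO (k * p , back)
    where
    back : iter f (k * p) (iter f k x) ≡ x
    back = begin
      iter f (k * p) (iter f k x) ≡⟨ iter-+ (k * p) k x ⟨
      iter f (k * p + k) x        ≡⟨ cong (λ z → iter f z x) (trans (+-comm (k * p) k) (sym (*-suc k p))) ⟩
      iter f (k * suc p) x        ≡⟨ iter-multiple ep k ⟩
      x                           ∎
      where open ≡-Reasoning

  IsRep⇒least : ∀ {r y} → IsRep r → SameOrbit r y → toℕ r ≤ toℕ y
  IsRep⇒least {r} isRep s with SO⇒Reaches s
  ... | k , refl with reduce r k
  ...   | k' , k'<n , e' = subst (λ z → toℕ r ≤ toℕ z) e' (All.lookup isRep (∈-upTo⁺ k'<n))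

  rep-unique : ∀ {r r'} → IsRep r → IsRep r' → SameOrbit r r' → r ≡ r'
  rep-unique a b s = FP.toℕ-injective (≤-antisym (IsRep⇒least a s) (IsRep⇒least b (SO-sym s)))

  private
    leastInOrbit : ∀ x → Σ (Fin n) λ y → SameOrbit x y × (∀ z → SameOrbit x z → toℕ y ≤ toℕ z)
    leastInOrbit x = least-Fin (sameOrbit? x) x SO-refl

  rep : Fin n → Fin n
  rep x = proj₁ (leastInOrbit x)

  rep-SO : ∀ x → SameOrbit x (rep x)
  rep-SO x = proj₁ (proj₂ (leastInOrbit x))

  rep-IsRep : ∀ x → IsRep (rep x)
  rep-IsRep x = All.tabulate λ {k} _ →
    proj₂ (proj₂ (leastInOrbit x)) (iter f k (rep x)) (SO-trans (rep-SO x) (SO-iter k (rep x)))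

  SO⇒rep≡ : ∀ {x y} → SameOrbit x y → rep x ≡ rep y
  SO⇒rep≡ {x} {y} s = rep-unique (rep-IsRep x) (rep-IsRep y)
                        (SO-trans (SO-sym (rep-SO x)) (SO-trans s (rep-SO y)))

  rep≡⇒SO : ∀ {x y} → rep x ≡ rep y → SameOrbit x y
  rep≡⇒SO {x} {y} e = SO-trans (rep-SO x) (subst (λ z → SameOrbit z y) (sym e) (SO-sym (rep-SO y)))

  -- If x does not return to itself in fewer than L steps, its orbit has at
  -- least L elements, namely x, f x, …, f^(L-1) x.
  orbit-size : ∀ L x → (∀ k → 0 < k → k < L → iter f k x ≢ x) →
               L ≤ ∑ (λ y → ind (sameOrbit? x y))
  orbit-size L x noReturn =
    injective-count (sameOrbit? x) (λ i → iter f (toℕ i) x) injective (λ i → SO-iter (toℕ i) x)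
    where
    apart : ∀ (i j : Fin L) → toℕ i < toℕ j → iter f (toℕ i) x ≢ iter f (toℕ j) x
    apart i j i<j e with m≤n⇒∃[o]m+o≡n i<j
    ... | k , j≡ = noReturn (suc k) (s≤s z≤n) steps<L returns
      where
      j≡′ : toℕ i + suc k ≡ toℕ j
      j≡′ = trans (+-suc (toℕ i) k) j≡
      steps<L : suc k < L
      steps<L = ≤-<-trans (≤-trans (m≤n+m (suc k) (toℕ i)) (≤-reflexive j≡′)) (FP.toℕ<n j)
      returns : iter f (suc k) x ≡ x
      returns = iter-injective (toℕ i) (begin
        iter f (toℕ i) (iter f (suc k) x) ≡⟨ iter-+ (toℕ i) (suc k) x ⟨
        iter f (toℕ i + suc k) x          ≡⟨ cong (λ m → iter f m x) j≡′ ⟩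
        iter f (toℕ j) x                  ≡⟨ e ⟨
        iter f (toℕ i) x                  ∎)
        where open ≡-Reasoning
    injective : ∀ {i j} → iter f (toℕ i) x ≡ iter f (toℕ j) x → i ≡ j
    injective {i} {j} e with <-cmp (toℕ i) (toℕ j)
    ... | tri< lt _ _ = ⊥-elim (apart i j lt e)
    ... | tri≈ _ eq _ = FP.toℕ-injective eq
    ... | tri> _ _ gt = ⊥-elim (apart j i gt (sym e))

cyc-spec : ∀ {m} (k : Fin (suc m)) →
           (toℕ k ≡ m × toℕ (cyc k) ≡ 0) ⊎ (toℕ k < m × toℕ (cyc k) ≡ suc (toℕ k))
cyc-spec {zero} fzero = inj₁ (refl , refl)
cyc-spec {suc m} fzero = inj₂ (s≤s z≤n , refl)
cyc-spec {suc m} (fsuc i) with cyc {m} i | cyc-spec {m} i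
... | fzero | inj₁ (e , _) = inj₁ (cong suc e , refl)
... | fsuc j | inj₂ (lt , e) = inj₂ (s≤s lt , cong suc e)

bool-two-colours : ∀ {a b c : Bool} → a ≢ b → b ≢ c → a ≡ c
bool-two-colours {false} {false} p q = ⊥-elim (p refl)
bool-two-colours {false} {true} {false} p q = refl
bool-two-colours {false} {true} {true} p q = ⊥-elim (q refl)
bool-two-colours {true} {false} {false} p q = ⊥-elim (q refl)
bool-two-colours {true} {false} {true} p q = refl
bool-two-colours {true} {true} p q = ⊥-elim (p refl)

module WebFacts (W : Web) where
  open Web W public

  -- σ has order three, so σ⁻¹ = σ ∘ σ and φ⁻¹ = α ∘ σ ∘ σ.
  σ⁻ : Fin n → Fin n
  σ⁻ x = σ (σ x)

  φ⁻ : Fin n → Fin n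
  φ⁻ x = α (σ (σ x))

  φφ⁻ : ∀ x → φ W (φ⁻ x) ≡ x
  φφ⁻ x = trans (cong σ (α-invol (σ (σ x)))) (σ-cube x)

  φ⁻φ : ∀ x → φ⁻ (φ W x) ≡ x
  φ⁻φ x = trans (cong α (σ-cube (α x))) (α-invol x)

  module Face = Orbit (φ W) φ⁻ φ⁻φ
  module Vertex = Orbit σ σ⁻ σ-cube

  SV : Fin n → Fin n → Set
  SV = SameVertex W

  SF : Fin n → Fin n → Set
  SF = SameFace W

  colour-SV : ∀ {x y} → SV x y → colour x ≡ colour y
  colour-SV s with Vertex.SO⇒Reaches s
  ... | k , refl = sym (colour-iter k _)
    where
    colour-iter : ∀ k x → colour (iter σ k x) ≡ colour x
    colour-iter zero x = refl
    colour-iter (suc k) x = trans (colour-σ _) (colour-iter k x)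

  colour-φ : ∀ x → circ x ≡ false → colour (φ W x) ≢ colour x
  colour-φ x c e = colour-α x c (trans (sym (colour-σ (α x))) e)

  SV-αφ : ∀ x → SV (α x) (φ W x)
  SV-αφ x = Vertex.SO-iter 1 (α x)

  φ≢α : ∀ x → φ W x ≢ α x
  φ≢α x = σ-free (α x)

  twoCycle : ∀ a b → circ a ≡ false → circ b ≡ false → SV (α a) b → SV (α b) a →
             b ≢ a → b ≢ α a → WebCycle W 1
  twoCycle a b ca cb ab ba b≢a b≢αa = d , webDart , next , apart , edges
    where
    a≁b : ¬ SV a b
    a≁b s = colour-α a ca (trans (colour-SV ab) (sym (colour-SV s)))
    d : Fin 2 → Fin n
    d fzero = a
    d (fsuc fzero) = b
    webDart : ∀ i → circ (d i) ≡ false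
    webDart fzero = ca
    webDart (fsuc fzero) = cb
    next : ∀ i → SV (α (d i)) (d (cyc i))
    next fzero = ab
    next (fsuc fzero) = ba
    apart : ∀ i j → i ≢ j → ¬ SV (d i) (d j)
    apart fzero fzero ne = ⊥-elim (ne refl)
    apart fzero (fsuc fzero) ne = a≁b
    apart (fsuc fzero) fzero ne = a≁b ∘ Vertex.SO-sym
    apart (fsuc fzero) (fsuc fzero) ne = ⊥-elim (ne refl)
    edges : ∀ i j → i ≢ j → (d j ≢ d i) × (d j ≢ α (d i))
    edges fzero fzero ne = ⊥-elim (ne refl)
    edges fzero (fsuc fzero) ne = b≢a , b≢αa
    edges (fsuc fzero) fzero ne =
      (λ e → b≢a (sym e)) , λ e → b≢αa (trans (sym (α-invol b)) (cong α (sym e)))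
    edges (fsuc fzero) (fsuc fzero) ne = ⊥-elim (ne refl)

  -- A closed walk of web darts through pairwise distinct vertices, of length
  -- at least 3 (cyc ∘ cyc has no fixed point), is a web cycle: its edges are
  -- automatically distinct.
  mkWebCycle : ∀ {m} (d : Fin (suc m) → Fin n) → (∀ i → circ (d i) ≡ false) →
               (∀ i → SV (α (d i)) (d (cyc i))) → (∀ i j → i ≢ j → ¬ SV (d i) (d j)) →
               (∀ i → i ≢ cyc (cyc i)) → WebCycle W m
  mkWebCycle d webDart next apart long = d , webDart , next , apart , edges
    where
    edges : ∀ i j → i ≢ j → (d j ≢ d i) × (d j ≢ α (d i))
    edges i j ne = (λ e → apart i j ne (subst (SV (d i)) (sym e) Vertex.SO-refl)) , notReverse
      where
      notReverse : d j ≢ α (d i)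
      notReverse e with j FP.≟ cyc i
      ... | no j≢ = apart j (cyc i) j≢ (subst (λ z → SV z (d (cyc i))) (sym e) (next i))
      ... | yes refl = apart i (cyc j) (long i)
              (subst (λ z → SV z (d (cyc j))) (trans (cong α e) (α-invol (d i))) (next j))

  -- In a non-elliptic web every interior face has at least six corners:
  -- faces of odd length are excluded by the bipartite colouring, and faces
  -- of length 2 or 4 would produce a web cycle of length 2 or 4.
  module InteriorFace (NE : NonElliptic W) (r : Fin n)
                      (interior : ∀ k → circ (iter (φ W) k r) ≡ false) where

    d : ℕ → Fin n
    d k = iter (φ W) k r

    alternates : ∀ k → colour (d (suc k)) ≢ colour (d k)
    alternates k = colour-φ (d k) (interior k)

    evenColour : ∀ k → colour (d (k * 2)) ≡ colour r
    evenColour zero = refl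
    evenColour (suc k) = trans (bool-two-colours (alternates (suc (k * 2))) (alternates (k * 2))) (evenColour k)

    noOddReturn : ∀ k → d (suc (k * 2)) ≢ r
    noOddReturn k e = alternates (k * 2) (trans (cong colour e) (sym (evenColour k)))

    noMultiEdge : ¬ WebCycle W 1
    noMultiEdge = NE 1 (s≤s (s≤s z≤n))

    noSquare : ¬ WebCycle W 3
    noSquare = NE 3 (s≤s (s≤s (s≤s (s≤s z≤n))))

    d₁≢r : d 1 ≢ r
    d₁≢r = noOddReturn 0

    d₂≢d₁ : d 2 ≢ d 1
    d₂≢d₁ e = d₁≢r (Face.iter-injective 1 e)

    -- A face of length 2 is a double edge.
    noReturn₂ : d 2 ≢ r
    noReturn₂ e = noMultiEdge (twoCycle r (d 1) (interior 0) (interior 1)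
                    (SV-αφ r) (subst (SV (α (d 1))) e (SV-αφ (d 1))) d₁≢r (φ≢α r))

    -- A face of length 4 is a 4-cycle, or a double edge if two opposite
    -- corners share a vertex.
    noReturn₄ : d 4 ≢ r
    noReturn₄ e with Vertex.sameOrbit? r (d 2) | Vertex.sameOrbit? (d 1) (d 3)
    ... | yes r~d₂ | _ = noMultiEdge (twoCycle r (d 1) (interior 0) (interior 1)
            (SV-αφ r) (Vertex.SO-trans (SV-αφ (d 1)) (Vertex.SO-sym r~d₂)) d₁≢r (φ≢α r))
    ... | no _ | yes d₁~d₃ = noMultiEdge (twoCycle (d 1) (d 2) (interior 1) (interior 2)
            (SV-αφ (d 1)) (Vertex.SO-trans (SV-αφ (d 2)) (Vertex.SO-sym d₁~d₃)) d₂≢d₁ (φ≢α (d 1)))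
    ... | no r≁d₂ | no d₁≁d₃ =
            noSquare (mkWebCycle (d ∘ toℕ) (interior ∘ toℕ) next apart long)
      where
      next : ∀ i → SV (α (d (toℕ i))) (d (toℕ (cyc i)))
      next fzero = SV-αφ (d 0)
      next (fsuc fzero) = SV-αφ (d 1)
      next (fsuc (fsuc fzero)) = SV-αφ (d 2)
      next (fsuc (fsuc (fsuc fzero))) = subst (SV (α (d 3))) e (SV-αφ (d 3))
      adjacent : ∀ k → ¬ SV (d k) (d (suc k))
      adjacent k s = alternates k (sym (colour-SV s))
      d₀≁d₃ : ¬ SV r (d 3)
      d₀≁d₃ s = adjacent 3 (Vertex.SO-trans (Vertex.SO-sym s) (subst (SV r) (sym e) Vertex.SO-refl))
      ordered : ∀ i j → i F.< j → ¬ SV (d (toℕ i)) (d (toℕ j))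
      ordered fzero (fsuc fzero) _ = adjacent 0
      ordered fzero (fsuc (fsuc fzero)) _ = r≁d₂
      ordered fzero (fsuc (fsuc (fsuc fzero))) _ = d₀≁d₃
      ordered (fsuc fzero) (fsuc (fsuc fzero)) _ = adjacent 1
      ordered (fsuc fzero) (fsuc (fsuc (fsuc fzero))) _ = d₁≁d₃
      ordered (fsuc (fsuc fzero)) (fsuc (fsuc (fsuc fzero))) _ = adjacent 2
      ordered (fsuc fzero) (fsuc fzero) (s≤s ())
      ordered (fsuc (fsuc i)) (fsuc fzero) (s≤s ())
      ordered (fsuc (fsuc i)) (fsuc (fsuc fzero)) (s≤s (s≤s ()))
      ordered (fsuc (fsuc (fsuc i))) (fsuc (fsuc (fsuc fzero))) (s≤s (s≤s (s≤s ())))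
      apart : ∀ i j → i ≢ j → ¬ SV (d (toℕ i)) (d (toℕ j))
      apart i j i≢j s with FP.<-cmp i j
      ... | tri< lt _ _ = ordered i j lt s
      ... | tri≈ _ eq _ = i≢j eq
      ... | tri> _ _ gt = ordered j i gt (Vertex.SO-sym s)
      long : ∀ (i : Fin 4) → i ≢ cyc (cyc i)
      long fzero ()
      long (fsuc fzero) ()
      long (fsuc (fsuc fzero)) ()
      long (fsuc (fsuc (fsuc fzero))) ()

    size≥6 : 6 ≤ ∑ (λ y → ind (Face.sameOrbit? r y))
    size≥6 = Face.orbit-size 6 r noShortReturn
      where
      noShortReturn : ∀ k → 0 < k → k < 6 → d k ≢ r
      noShortReturn 1 _ _ = noOddReturn 0
      noShortReturn 2 _ _ = noReturn₂
      noShortReturn 3 _ _ = noOddReturn 1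
      noShortReturn 4 _ _ = noReturn₄
      noShortReturn 5 _ _ = noOddReturn 2
      noShortReturn (suc (suc (suc (suc (suc (suc _)))))) _ (s≤s (s≤s (s≤s (s≤s (s≤s (s≤s ()))))))

-- The arithmetic core of the counting argument:  6|V| ≤ Σ|f| = Σ ed + 4|E|
-- together with exactness 4|V| = 2|E| + Σ ed gives |V| ≤ |E|.
levels⇒V≤E : ∀ v e g t → 6 * v ≤ t → t ≡ g + 4 * e → 4 * v ≡ 2 * e + g → v ≤ e
levels⇒V≤E v e g t six≤t total exact = *-cancelˡ-≤ 2 (+-cancelˡ-≤ (2 * e + g) _ _ (begin
  (2 * e + g) + 2 * v ≡⟨ cong (_+ 2 * v) exact ⟨
  4 * v + 2 * v       ≡⟨ *-distribʳ-+ v 4 2 ⟨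
  6 * v               ≤⟨ six≤t ⟩
  t                   ≡⟨ total ⟩
  g + 4 * e           ≡⟨ regroup g e ⟩
  (2 * e + g) + 2 * e ∎))
  where
  open ≤-Reasoning
  regroup : ∀ g e → g + 4 * e ≡ (2 * e + g) + 2 * e
  regroup = solve-∀

level≃0 : ∀ a b c → ((ℤ.+ a ℤ.- ℤ.+ b) ℤ.- ℤ.+ c) ℚ./ 2 ≃ 0ℚᵘ → a ≡ b + c
level≃0 a b c (*≡* eq) = ℤP.+-injective (ℤP.i-j≡0⇒i≡j (ℤ.+ a) (ℤ.+ (b + c)) (begin
  ℤ.+ a ℤ.- ℤ.+ (b + c)                   ≡⟨ cong (λ w → ℤ.+ a ℤ.- w) (ℤP.pos-+ b c) ⟩
  ℤ.+ a ℤ.+ ℤ.- (ℤ.+ b ℤ.+ ℤ.+ c)         ≡⟨ cong (λ w → ℤ.+ a ℤ.+ w) (ℤP.neg-distrib-+ (ℤ.+ b) (ℤ.+ c)) ⟩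
  ℤ.+ a ℤ.+ (ℤ.- ℤ.+ b ℤ.- ℤ.+ c)         ≡⟨ ℤP.+-assoc (ℤ.+ a) (ℤ.- ℤ.+ b) (ℤ.- ℤ.+ c) ⟨
  (ℤ.+ a ℤ.- ℤ.+ b) ℤ.- ℤ.+ c             ≡⟨ ℤP.*-identityʳ _ ⟨
  ((ℤ.+ a ℤ.- ℤ.+ b) ℤ.- ℤ.+ c) ℤ.* ℤ.+ 1 ≡⟨ eq ⟩
  ℤ.+ 0                                   ∎))
  where open ≡-Reasoning

sum-filter : ∀ {m N} {P : Fin N → Set} (P? : Decidable P) (h : Fin N → ℕ) (f : Fin m → Fin N) →
             sum (map h (filter P? (tabulate f))) ≡ ∑ (λ i → ind (P? (f i)) * h (f i))
sum-filter {zero} P? h f = refl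
sum-filter {suc m} P? h f with P? (f fzero)
... | yes _ = cong₂ _+_ (sym (+-identityʳ (h (f fzero)))) (sum-filter P? h (f ∘ fsuc))
... | no _ = sum-filter P? h (f ∘ fsuc)

-- Counting in a red graph G: the total number of corners of the faces of G
-- is computed in two ways.
module RedGraphCount (W : Web) (G : RedGraph W) where
  open WebFacts W
  open RedGraph G

  V E gray : ℕ
  V = numV W G
  E = numE W G
  gray = ∑ (λ d → ind (in? W G d ×-dec gray? W G d))

  corners : ℕ
  corners = ∑ (λ d → ind (in? W G d))

  V≡∑ : V ≡ ∑ (λ r → ind (isVertexG? W G r))
  V≡∑ = count≡∑ (isVertexG? W G) (λ x → x)

  E≡∑ : E ≡ ∑ (λ d → ind (isEdgeG? W G d))
  E≡∑ = count≡∑ (isEdgeG? W G) (λ x → x)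

  In-SF : ∀ {x y} → SF x y → In W G x → In W G y
  In-SF s p with Face.SO⇒Reaches s
  ... | k , refl = trans (inG-iter k _) p
    where
    inG-iter : ∀ k x → inG (iter (φ W) k x) ≡ inG x
    inG-iter zero x = refl
    inG-iter (suc k) x = trans (inG-face _) (inG-iter k x)

  module _ {Q : Fin n → Set} (Q? : Decidable Q) where
    inFace : Fin n → Fin n → ℕ
    inFace r d = ind (isVertexG? W G r) * ind (Face.sameOrbit? r d ×-dec Q? d)

    -- a corner d lies in exactly one face of G, the one represented by rep d
    inFace≡ : ∀ r d → inFace r d ≡ ind (r FP.≟ Face.rep d) * ind (in? W G d ×-dec Q? d)
    inFace≡ r d = begin
      inFace r d
        ≡⟨ ind-× (isVertexG? W G r) (Face.sameOrbit? r d ×-dec Q? d) ⟨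
      ind (isVertexG? W G r ×-dec (Face.sameOrbit? r d ×-dec Q? d))
        ≡⟨ ind-cong to from _ ((r FP.≟ Face.rep d) ×-dec (in? W G d ×-dec Q? d)) ⟩
      ind ((r FP.≟ Face.rep d) ×-dec (in? W G d ×-dec Q? d))
        ≡⟨ ind-× (r FP.≟ Face.rep d) (in? W G d ×-dec Q? d) ⟩
      ind (r FP.≟ Face.rep d) * ind (in? W G d ×-dec Q? d) ∎
      where
      open ≡-Reasoning
      to : IsVertexG W G r × (SF r d × Q d) → (r ≡ Face.rep d) × (In W G d × Q d)
      to ((ir , isRep) , (s , q)) =
        Face.rep-unique isRep (Face.rep-IsRep d) (Face.SO-trans s (Face.rep-SO d)) , In-SF s ir , q
      from : (r ≡ Face.rep d) × (In W G d × Q d) → IsVertexG W G r × (SF r d × Q d)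
      from (refl , (id , q)) =
        (In-SF (Face.rep-SO d) id , Face.rep-IsRep d) , Face.SO-sym (Face.rep-SO d) , q

    double-count : ∑ (λ r → ind (isVertexG? W G r) * ∑ (λ d → ind (Face.sameOrbit? r d ×-dec Q? d)))
                   ≡ ∑ (λ d → ind (in? W G d ×-dec Q? d))
    double-count = begin
      ∑ (λ r → ind (isVertexG? W G r) * ∑ (λ d → ind (Face.sameOrbit? r d ×-dec Q? d)))
        ≡⟨ sum-cong-≗ {n} (λ r → *-distribˡ-sum (ind (isVertexG? W G r)) (λ d → ind (Face.sameOrbit? r d ×-dec Q? d))) ⟩
      ∑ (λ r → ∑ (λ d → inFace r d))
        ≡⟨ ∑-comm inFace ⟩
      ∑ (λ d → ∑ (λ r → inFace r d))
        ≡⟨ sum-cong-≗ {n} (λ d → trans (sum-cong-≗ {n} (λ r → inFace≡ r d)) (one-face d)) ⟩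
      ∑ (λ d → ind (in? W G d ×-dec Q? d)) ∎
      where
      open ≡-Reasoning
      one-face : ∀ d → ∑ (λ r → ind (r FP.≟ Face.rep d) * ind (in? W G d ×-dec Q? d))
                       ≡ ind (in? W G d ×-dec Q? d)
      one-face d = begin
        ∑ (λ r → ind (r FP.≟ Face.rep d) * X) ≡⟨ sum-cong-≗ {n} (λ r → *-comm (ind (r FP.≟ Face.rep d)) X) ⟩
        ∑ (λ r → X * ind (r FP.≟ Face.rep d)) ≡⟨ *-distribˡ-sum X (λ r → ind (r FP.≟ Face.rep d)) ⟨
        X * ∑ (λ r → ind (r FP.≟ Face.rep d)) ≡⟨ cong (X *_) (∑-point (Face.rep d)) ⟩
        X * 1                                 ≡⟨ *-identityʳ X ⟩
        X                                     ∎
        where X = ind (in? W G d ×-dec Q? d)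

  sumEd≡gray : sumEd W G ≡ gray
  sumEd≡gray = begin
    sumEd W G
      ≡⟨ sum-filter (isVertexG? W G) (ed W G) (λ x → x) ⟩
    ∑ (λ r → ind (isVertexG? W G r) * ed W G r)
      ≡⟨ sum-cong-≗ {n} (λ r → cong (ind (isVertexG? W G r) *_)
           (count≡∑ (λ d → Face.sameOrbit? r d ×-dec gray? W G d) (λ x → x))) ⟩
    ∑ (λ r → ind (isVertexG? W G r) * ∑ (λ d → ind (Face.sameOrbit? r d ×-dec gray? W G d)))
      ≡⟨ double-count (gray? W G) ⟩
    gray ∎
    where open ≡-Reasoning

  six-corners : NonElliptic W → 6 * V ≤ corners
  six-corners NE = begin
    6 * V
      ≡⟨ cong (6 *_) V≡∑ ⟩
    6 * ∑ (λ r → ind (isVertexG? W G r))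
      ≡⟨ *-distribˡ-sum 6 (λ r → ind (isVertexG? W G r)) ⟩
    ∑ (λ r → 6 * ind (isVertexG? W G r))
      ≤⟨ ∑-mono {n} faceSize ⟩
    ∑ (λ r → ind (isVertexG? W G r) * ∑ (λ d → ind (Face.sameOrbit? r d ×-dec yes tt)))
      ≡⟨ double-count (λ _ → yes tt) ⟩
    ∑ (λ d → ind (in? W G d ×-dec yes tt))
      ≡⟨ sum-cong-≗ {n} (λ d → trans (ind-× (in? W G d) (yes tt)) (*-identityʳ _)) ⟩
    corners ∎
    where
    open ≤-Reasoning
    faceSize : ∀ r → 6 * ind (isVertexG? W G r)
                     ≤ ind (isVertexG? W G r) * ∑ (λ d → ind (Face.sameOrbit? r d ×-dec yes tt))
    faceSize r with isVertexG? W G r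
    ... | no _ = z≤n
    ... | yes (ir , _) = begin
      6 * 1                                              ≤⟨ InteriorFace.size≥6 NE r interior ⟩
      ∑ (λ d → ind (Face.sameOrbit? r d))                ≡⟨ sum-cong-≗ {n} (λ d → sym (trans (ind-× (Face.sameOrbit? r d) (yes tt)) (*-identityʳ _))) ⟩
      ∑ (λ d → ind (Face.sameOrbit? r d ×-dec yes tt))   ≡⟨ +-identityʳ _ ⟨
      1 * ∑ (λ d → ind (Face.sameOrbit? r d ×-dec yes tt)) ∎
      where
      interior : ∀ k → circ (iter (φ W) k r) ≡ false
      interior k = inG-interior _ (In-SF (Face.SO-iter k r) ir)

  -- The corner d of a face of G is followed by the half-edge σ d, which
  -- separates the face of σ d (= the face across the edge of d) from the
  -- face of σ (σ d).  At most one of them is in G, and σ d is gray iff neither is.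
  acrossEdge acrossNext : Fin n → ℕ
  acrossEdge d = ind (in? W G d ×-dec in? W G (α d))
  acrossNext d = ind (in? W G d ×-dec in? W G (σ (σ d)))

  corner-classification : ∀ d → ind (in? W G d)
                              ≡ ind (in? W G d ×-dec gray? W G d) + (acrossEdge d + acrossNext d)
  corner-classification d =
    trans (ind-split (in? W G d) (gray? W G d))
          (cong (ind (in? W G d ×-dec gray? W G d) +_)
            (classify (inG d) (inG (σ d)) (inG (α d)) (inG (σ (σ d))) inGσ (no-triple d)))
    where
    inGσ : inG (σ d) ≡ inG (α d)
    inGσ = trans (cong (λ z → inG (σ z)) (sym (α-invol d))) (inG-face (α d))
    classify : ∀ (a b b' c : Bool) → b ≡ b' → (a ≡ true → b ≡ true → c ≡ true → ⊥) →
       ind ((a Bool.≟ true) ×-dec ¬? ((b Bool.≟ false) ×-dec (c Bool.≟ false)))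
       ≡ ind ((a Bool.≟ true) ×-dec (b' Bool.≟ true)) + ind ((a Bool.≟ true) ×-dec (c Bool.≟ true))
    classify false b .b c refl _ = refl
    classify true false .false false refl _ = refl
    classify true false .false true refl _ = refl
    classify true true .true false refl _ = refl
    classify true true .true true refl triple = ⊥-elim (triple refl refl refl)

  -- Each edge of G is counted from both of its sides.
  ∑acrossEdge≡2E : ∑ acrossEdge ≡ E + E
  ∑acrossEdge≡2E = begin
    ∑ acrossEdge
      ≡⟨ sum-cong-≗ {n} bothSides ⟩
    ∑ (λ d → ind (isEdgeG? W G d) + ind (isEdgeG? W G (α d)))
      ≡⟨ ∑-distrib-+ (λ d → ind (isEdgeG? W G d)) (λ d → ind (isEdgeG? W G (α d))) ⟩
    ∑ (λ d → ind (isEdgeG? W G d)) + ∑ (λ d → ind (isEdgeG? W G (α d)))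
      ≡⟨ cong (∑ (λ d → ind (isEdgeG? W G d)) +_)
           (∑-permute (λ d → ind (isEdgeG? W G d)) (permutation α α α-invol α-invol)) ⟨
    ∑ (λ d → ind (isEdgeG? W G d)) + ∑ (λ d → ind (isEdgeG? W G d))
      ≡⟨ cong₂ _+_ E≡∑ E≡∑ ⟨
    E + E ∎
    where
    open ≡-Reasoning
    bothSides : ∀ d → acrossEdge d ≡ ind (isEdgeG? W G d) + ind (isEdgeG? W G (α d))
    bothSides d = trans (ind-split (in? W G d ×-dec in? W G (α d)) (toℕ d <? toℕ (α d)))
      (cong₂ _+_
        (ind-cong (λ { ((p , q) , r) → p , q , r }) (λ { (p , q , r) → (p , q) , r })
          ((in? W G d ×-dec in? W G (α d)) ×-dec (toℕ d <? toℕ (α d))) (isEdgeG? W G d))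
        (ind-cong (λ { ((p , q) , r) → q , subst (In W G) (sym (α-invol d)) p ,
                         subst (λ z → toℕ (α d) < toℕ z) (sym (α-invol d)) (≤∧≢⇒< (≮⇒≥ r) distinct) })
                  (λ { (p , q , r) → (subst (In W G) (α-invol d) q , p) ,
                         (λ lt → <-asym lt (subst (λ z → toℕ (α d) < toℕ z) (α-invol d) r)) })
                  ((in? W G d ×-dec in? W G (α d)) ×-dec ¬? (toℕ d <? toℕ (α d))) (isEdgeG? W G (α d))))
      where
      distinct : toℕ (α d) ≢ toℕ d
      distinct e = α-free d (FP.toℕ-injective e)

  -- Reindexing by σ⁻ turns "next face in G" into "face across the edge in G".
  ∑acrossNext≡∑acrossEdge : ∑ acrossNext ≡ ∑ acrossEdge
  ∑acrossNext≡∑acrossEdge =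
    sym (trans (∑-permute acrossEdge (permutation σ⁻ σ σ-cube σ-cube)) (sum-cong-≗ {n} shift))
    where
    inGασσ : ∀ d → inG (α (σ (σ d))) ≡ inG d
    inGασσ d = trans (sym (inG-face (α (σ (σ d))))) (cong inG (φφ⁻ d))
    shift : ∀ d → acrossEdge (σ⁻ d) ≡ acrossNext d
    shift d = ind-cong (λ { (p , q) → trans (sym (inGασσ d)) q , p })
                       (λ { (p , q) → q , trans (inGασσ d) p }) _ _

  corners≡ : corners ≡ gray + 4 * E
  corners≡ = begin
    corners
      ≡⟨ sum-cong-≗ {n} corner-classification ⟩
    ∑ (λ d → ind (in? W G d ×-dec gray? W G d) + (acrossEdge d + acrossNext d))
      ≡⟨ ∑-distrib-+ (λ d → ind (in? W G d ×-dec gray? W G d)) (λ d → acrossEdge d + acrossNext d) ⟩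
    gray + ∑ (λ d → acrossEdge d + acrossNext d)
      ≡⟨ cong (gray +_) (∑-distrib-+ acrossEdge acrossNext) ⟩
    gray + (∑ acrossEdge + ∑ acrossNext)
      ≡⟨ cong (λ x → gray + (∑ acrossEdge + x)) ∑acrossNext≡∑acrossEdge ⟩
    gray + (∑ acrossEdge + ∑ acrossEdge)
      ≡⟨ cong (λ x → gray + (x + x)) ∑acrossEdge≡2E ⟩
    gray + ((E + E) + (E + E))
      ≡⟨ cong (gray +_) (fourfold E) ⟩
    gray + 4 * E ∎
    where
    open ≡-Reasoning
    fourfold : ∀ e → (e + e) + (e + e) ≡ 4 * e
    fourfold = solve-∀

  exact⇒V≤E : NonElliptic W → Exact W G → V ≤ E
  exact⇒V≤E NE ex = levels⇒V≤E V E gray corners (six-corners NE) corners≡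
    (trans (level≃0 (4 * V) (2 * E) (sumEd W G) ex) (cong (2 * E +_) sumEd≡gray))

-- Cycles in the dual multigraph of a red graph.  Its vertices are the faces
-- of G and a dart d with both d and α d in faces of G is a half of the dual
-- edge crossing the web edge {d, α d}.
module DualCycles (W : Web) (G : RedGraph W) where
  open WebFacts W
  open RedGraphCount W G using (In-SF)

  loopCycle : ∀ d → In W G d → SF d (α d) → HasCycle W G
  loopCycle d p d~αd = 0 , (λ _ → d) , (λ _ → p) , next , apart , edges
    where
    next : ∀ (i : Fin 1) → SF (α d) d
    next fzero = Face.SO-sym d~αd
    apart : ∀ (i j : Fin 1) → i ≢ j → ¬ SF d d
    apart fzero fzero ne = ⊥-elim (ne refl)
    edges : ∀ (i j : Fin 1) → i ≢ j → (d ≢ d) × (d ≢ α d)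
    edges fzero fzero ne = ⊥-elim (ne refl)

  -- A walk that never leaves an edge by the reverse dart it came in by
  -- closes a cycle.  `continue` chooses, for every dual edge x, a next dual
  -- edge y starting in the face where x ends, other than α x.
  module Walk (P : Fin n → Set) (P⇒In : ∀ {x} → P x → In W G x)
    (continue : ∀ x → P x → P (α x) → Σ (Fin n) λ y → (P y × P (α y)) × SF (α x) y × y ≢ α x)
    (x₀ : Fin n) (p₀ : P x₀) (q₀ : P (α x₀)) where

    DualEdge : Set
    DualEdge = Σ (Fin n) λ x → P x × P (α x)

    step : DualEdge → DualEdge
    step (x , p , q) = proj₁ (continue x p q) , proj₁ (proj₂ (continue x p q))

    walk : ℕ → DualEdge
    walk zero = x₀ , p₀ , q₀
    walk (suc k) = step (walk k)

    dart : ℕ → Fin n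
    dart k = proj₁ (walk k)

    dart-P : ∀ k → P (dart k)
    dart-P k = proj₁ (proj₂ (walk k))

    dart-next : ∀ k → SF (α (dart k)) (dart (suc k))
    dart-next k with walk k
    ... | x , p , q = proj₁ (proj₂ (proj₂ (continue x p q)))

    dart-noBacktrack : ∀ k → dart (suc k) ≢ α (dart k)
    dart-noBacktrack k with walk k
    ... | x , p , q = proj₂ (proj₂ (proj₂ (continue x p q)))

    face : ℕ → Fin n
    face k = Face.rep (dart k)

    Revisit : ℕ → Set
    Revisit j = ∃ λ (i : Fin j) → face (toℕ i) ≡ face j

    -- there are only n faces, so some face is revisited; take the first revisit J
    abstract
      firstRevisit : Σ ℕ λ j → Revisit j × (∀ i → i < j → ¬ Revisit i)
      firstRevisit with FP.pigeonhole (n<1+n n) (λ (i : Fin (suc n)) → face (toℕ i))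
      ... | i , j , i<j , e = least-ℕ (λ j → FP.any? (λ i → face (toℕ i) FP.≟ face j)) (toℕ j)
                                (F.fromℕ< i<j , trans (cong face (FP.toℕ-fromℕ< i<j)) e)

    J I : ℕ
    J = proj₁ firstRevisit
    I = toℕ (proj₁ (proj₁ (proj₂ firstRevisit)))

    I<J : I < J
    I<J = FP.toℕ<n (proj₁ (proj₁ (proj₂ firstRevisit)))

    face-I≡J : face I ≡ face J
    face-I≡J = proj₂ (proj₁ (proj₂ firstRevisit))

    noEarlierRevisit : ∀ {a b} → a < b → b < J → face a ≢ face b
    noEarlierRevisit a<b b<J e =
      proj₂ (proj₂ firstRevisit) _ b<J (F.fromℕ< a<b , trans (cong face (FP.toℕ-fromℕ< a<b)) e)

    faces-distinct : ∀ a b → a < J → b < J → face a ≡ face b → a ≡ b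
    faces-distinct a b a<J b<J e with <-cmp a b
    ... | tri< a<b _ _ = ⊥-elim (noEarlierRevisit a<b b<J e)
    ... | tri≈ _ a≡b _ = a≡b
    ... | tri> _ _ b<a = ⊥-elim (noEarlierRevisit b<a a<J (sym e))

    -- between steps I and J the walk never crosses an edge twice: a reversed
    -- edge would either be an immediate backtrack, or force a revisit
    -- before step J
    noReversal : ∀ a b → a < J → b < J → a ≢ b → dart b ≢ α (dart a)
    noReversal a b a<J b<J a≢b e = afterA (m≤n⇒m<n∨m≡n a<J)
      where
      face-b≡1+a : face b ≡ face (suc a)
      face-b≡1+a = Face.SO⇒rep≡ (subst (λ z → SF z (dart (suc a))) (sym e) (dart-next a))
      afterA : suc a < J ⊎ suc a ≡ J → ⊥
      afterA (inj₁ 1+a<J) = dart-noBacktrack a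
        (subst (λ k → dart k ≡ α (dart a)) (faces-distinct b (suc a) b<J 1+a<J face-b≡1+a) e)
      afterA (inj₂ 1+a≡J) = afterI (m≤n⇒m<n∨m≡n I<J)
        where
        b≡I : b ≡ I
        b≡I = faces-distinct b I b<J I<J (trans face-b≡1+a (trans (cong face 1+a≡J) (sym face-I≡J)))
        αI≡a : α (dart I) ≡ dart a
        αI≡a = trans (cong (α ∘ dart) (sym b≡I)) (trans (cong α e) (α-invol (dart a)))
        afterI : suc I < J ⊎ suc I ≡ J → ⊥
        afterI (inj₁ 1+I<J) = dart-noBacktrack I (subst (λ k → dart k ≡ α (dart I)) a≡1+I (sym αI≡a))
          where
          a≡1+I : a ≡ suc I
          a≡1+I = faces-distinct a (suc I) a<J 1+I<J
                    (Face.SO⇒rep≡ (subst (λ z → SF z (dart (suc I))) αI≡a (dart-next I)))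
        afterI (inj₂ 1+I≡J) = a≢b (trans (suc-injective (trans 1+a≡J (sym 1+I≡J))) (sym b≡I))

    -- the cycle runs through steps I, I+1, …, J-1
    length-1 : ℕ
    length-1 = proj₁ (m≤n⇒∃[o]m+o≡n I<J)

    I+length≡J : suc I + length-1 ≡ J
    I+length≡J = proj₂ (m≤n⇒∃[o]m+o≡n I<J)

    step# : Fin (suc length-1) → ℕ
    step# k = I + toℕ k

    step#<J : ∀ k → step# k < J
    step#<J k = ≤-trans (s≤s (+-monoʳ-≤ I (FP.toℕ≤pred[n] k))) (≤-reflexive I+length≡J)

    step#-injective : ∀ {a b} → step# a ≡ step# b → a ≡ b
    step#-injective e = FP.toℕ-injective (+-cancelˡ-≡ I _ _ e)

    cycleDart : Fin (suc length-1) → Fin n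
    cycleDart k = dart (step# k)

    -- consecutive darts of the cycle; the last one returns to face I = face J
    cycle-next : ∀ k → SF (α (cycleDart k)) (cycleDart (cyc k))
    cycle-next k with cyc-spec k
    ... | inj₂ (_ , cyc≡) = subst (λ z → SF (α (cycleDart k)) (dart z)) 1+step≡ (dart-next (step# k))
      where
      1+step≡ : suc (step# k) ≡ step# (cyc k)
      1+step≡ = sym (trans (cong (I +_) cyc≡) (+-suc I _))
    ... | inj₁ (k≡last , cyc≡0) = Face.SO-trans
            (subst (λ z → SF (α (cycleDart k)) (dart z)) 1+step≡J (dart-next (step# k)))
            (subst (λ z → SF (dart J) (dart z)) I≡step (Face.rep≡⇒SO (sym face-I≡J)))
      where
      1+step≡J : suc (step# k) ≡ J
      1+step≡J = trans (cong (λ z → suc (I + z)) k≡last) I+length≡J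
      I≡step : I ≡ step# (cyc k)
      I≡step = sym (trans (cong (I +_) cyc≡0) (+-identityʳ I))

    cycle : HasCycle W G
    cycle = length-1 , cycleDart , (λ k → P⇒In (dart-P (step# k))) , cycle-next , apart , edges
      where
      apart : ∀ a b → a ≢ b → ¬ SF (cycleDart a) (cycleDart b)
      apart a b a≢b s = a≢b (step#-injective
        (faces-distinct (step# a) (step# b) (step#<J a) (step#<J b) (Face.SO⇒rep≡ s)))
      edges : ∀ a b → a ≢ b → (cycleDart b ≢ cycleDart a) × (cycleDart b ≢ α (cycleDart a))
      edges a b a≢b = (λ e → apart a b a≢b (subst (SF (cycleDart a)) (sym e) Face.SO-refl))
                    , noReversal (step# a) (step# b) (step#<J a) (step#<J b) (a≢b ∘ step#-injective)

  -- An induced subgraph of the dual multigraph: a set of faces of G, given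
  -- as a face-invariant set of corners.
  record SubGraph : Set₁ where
    field
      P    : Fin n → Set
      P?   : Decidable P
      P⇒In : ∀ {x} → P x → In W G x
      P-SF : ∀ {x y} → SF x y → P x → P y

  module _ (H : SubGraph) where
    open SubGraph H

    #V : ℕ
    #V = ∑ (λ r → ind (P? r ×-dec Face.isRep? r))

    #E : ℕ
    #E = ∑ (λ d → ind (P? d ×-dec (P? (α d) ×-dec (toℕ d <? toℕ (α d)))))

    degree : Fin n → ℕ
    degree r = ∑ (λ d → ind (Face.sameOrbit? r d ×-dec P? (α d)))

    someEdge : 1 ≤ #E → Σ (Fin n) λ d → P d × P (α d)
    someEdge h with ∑-positive _ h
    ... | d , i with ind-witness (P? d ×-dec (P? (α d) ×-dec (toℕ d <? toℕ (α d)))) i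
    ...   | p , q , _ = d , p , q

    someFace : ∀ x → P x → 1 ≤ #V
    someFace x p = ≤-trans (≤-reflexive (sym (ind-true (P? (Face.rep x) ×-dec Face.isRep? (Face.rep x))
                                                      (P-SF (Face.rep-SO x) p , Face.rep-IsRep x))))
                           (∑-term≤ (λ r → ind (P? r ×-dec Face.isRep? r)) (Face.rep x))

  -- Removing a face r of degree ≤ 1 loses one vertex and at most one edge.
  module RemoveLeaf (H : SubGraph) (r : Fin n) (pr : SubGraph.P H r) (isRep : Face.IsRep r)
                    (leaf : degree H r ≤ 1)
                    (noLoop : ¬ (∃ λ d → SubGraph.P H d × SubGraph.P H (α d) × SF d (α d))) where
    open SubGraph H

    H′ : SubGraph
    H′ = record { P = λ x → P x × ¬ SF r x
                ; P? = λ x → P? x ×-dec ¬? (Face.sameOrbit? r x)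
                ; P⇒In = λ p → P⇒In (proj₁ p)
                ; P-SF = λ sf p → P-SF sf (proj₁ p) , (λ sr → proj₂ p (Face.SO-trans sr (Face.SO-sym sf))) }

    #V-removal : #V H ≡ suc (#V H′)
    #V-removal = trans (count-remove (λ x → P? x ×-dec Face.isRep? x) r (pr , isRep))
                       (cong suc (sum-cong-≗ {n} otherFaces))
      where
      otherFaces : ∀ x → ind ((P? x ×-dec Face.isRep? x) ×-dec ¬? (x FP.≟ r))
                         ≡ ind ((P? x ×-dec ¬? (Face.sameOrbit? r x)) ×-dec Face.isRep? x)
      otherFaces x = ind-cong
        (λ { ((px , rx) , ne) → (px , (λ sr → ne (sym (Face.rep-unique isRep rx sr)))) , rx })
        (λ { ((px , nsr) , rx) → (px , rx) , (λ e → nsr (subst (SF r) (sym e) Face.SO-refl)) })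
        ((P? x ×-dec Face.isRep? x) ×-dec ¬? (x FP.≟ r)) ((P? x ×-dec ¬? (Face.sameOrbit? r x)) ×-dec Face.isRep? x)

    -- an edge of H either avoids r, or has its lower or its upper dart in r
    edge? : (d : Fin n) → Dec (P d × P (α d) × toℕ d < toℕ (α d))
    edge? d = P? d ×-dec (P? (α d) ×-dec (toℕ d <? toℕ (α d)))
    edge′? : (d : Fin n) → Dec (SubGraph.P H′ d × SubGraph.P H′ (α d) × toℕ d < toℕ (α d))
    edge′? d = SubGraph.P? H′ d ×-dec (SubGraph.P? H′ (α d) ×-dec (toℕ d <? toℕ (α d)))

    atR? : (d : Fin n) → Dec (SF r d × P (α d))
    atR? d = Face.sameOrbit? r d ×-dec P? (α d)
    lowEndAt-r? : (d : Fin n) → Dec ((SF r d × P (α d)) × toℕ d < toℕ (α d))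
    lowEndAt-r? d = atR? d ×-dec (toℕ d <? toℕ (α d))
    highEndAt-r? : (d : Fin n) → Dec ((SF r d × P (α d)) × toℕ (α d) < toℕ d)
    highEndAt-r? d = atR? d ×-dec (toℕ (α d) <? toℕ d)

    edgeOfH′ lowEndAt-r highEndAt-r : Fin n → ℕ
    edgeOfH′ d = ind (edge′? d)
    lowEndAt-r d = ind (lowEndAt-r? d)
    highEndAt-r d = ind (highEndAt-r? d)

    edge-cases : ∀ d → ind (edge? d) ≤ edgeOfH′ d + (lowEndAt-r d + highEndAt-r (α d))
    edge-cases d = ind-cover₃ (edge? d) (edge′? d) (lowEndAt-r? d) (highEndAt-r? (α d)) cases
      where
      cases : P d × P (α d) × toℕ d < toℕ (α d) →
              (SubGraph.P H′ d × SubGraph.P H′ (α d) × toℕ d < toℕ (α d))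
              ⊎ ((SF r d × P (α d)) × toℕ d < toℕ (α d))
              ⊎ ((SF r (α d) × P (α (α d))) × toℕ (α (α d)) < toℕ (α d))
      cases (p , q , lt) with Face.sameOrbit? r d | Face.sameOrbit? r (α d)
      ... | yes r~d | _ = inj₂ (inj₁ ((r~d , q) , lt))
      ... | no _ | yes r~αd = inj₂ (inj₂ ((r~αd , subst P (sym (α-invol d)) p) ,
                                subst (λ z → toℕ z < toℕ (α d)) (sym (α-invol d)) lt))
      ... | no r≁d | no r≁αd = inj₁ ((p , r≁d) , ((q , r≁αd) , lt))

    ends≤degree : ∀ d → lowEndAt-r d + highEndAt-r d ≤ ind (atR? d)
    ends≤degree d = ind-disjoint (atR? d) (lowEndAt-r? d) (highEndAt-r? d)
                      (λ x y → <-asym (proj₂ x) (proj₂ y)) proj₁ proj₁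

    #E-removal : #E H ≤ #E H′ + 1
    #E-removal = begin
      #E H                                                          ≤⟨ ∑-mono {n} edge-cases ⟩
      ∑ (λ d → edgeOfH′ d + (lowEndAt-r d + highEndAt-r (α d)))     ≡⟨ ∑-distrib-+ edgeOfH′ (λ d → lowEndAt-r d + highEndAt-r (α d)) ⟩
      #E H′ + ∑ (λ d → lowEndAt-r d + highEndAt-r (α d))            ≡⟨ cong (#E H′ +_) (∑-distrib-+ lowEndAt-r (highEndAt-r ∘ α)) ⟩
      #E H′ + (∑ lowEndAt-r + ∑ (highEndAt-r ∘ α))                  ≡⟨ cong (λ x → #E H′ + (∑ lowEndAt-r + x))
                                                                         (∑-permute highEndAt-r (permutation α α α-invol α-invol)) ⟨
      #E H′ + (∑ lowEndAt-r + ∑ highEndAt-r)                        ≡⟨ cong (#E H′ +_) (∑-distrib-+ lowEndAt-r highEndAt-r) ⟨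
      #E H′ + ∑ (λ d → lowEndAt-r d + highEndAt-r d)                ≤⟨ +-monoʳ-≤ (#E H′) (≤-trans (∑-mono {n} ends≤degree) leaf) ⟩
      #E H′ + 1                                                     ∎
      where open ≤-Reasoning

    #V≤#E-removal : #V H ≤ #E H → #V H′ ≤ #E H′
    #V≤#E-removal h = s≤s⁻¹ (begin
      suc (#V H′) ≡⟨ #V-removal ⟨
      #V H        ≤⟨ h ⟩
      #E H        ≤⟨ #E-removal ⟩
      #E H′ + 1   ≡⟨ +-comm (#E H′) 1 ⟩
      suc (#E H′) ∎)
      where open ≤-Reasoning

    -- H′ keeps an edge: since H has an edge, H′ has a face (an endpoint of that
    -- edge other than r, which exists as the edge is not a loop), hence an edge.
    edge-removal : #V H ≤ #E H → 1 ≤ #E H → 1 ≤ #E H′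
    edge-removal h h1 with someEdge H h1
    ... | d , p , q with Face.sameOrbit? r d
    ...   | no r≁d = ≤-trans (someFace H′ d (p , r≁d)) (#V≤#E-removal h)
    ...   | yes r~d = ≤-trans (someFace H′ (α d) (q , λ r~αd → noLoop (d , p , q , Face.SO-trans (Face.SO-sym r~d) r~αd)))
                              (#V≤#E-removal h)

  cycle-from-counts : ∀ k (H : SubGraph) → #V H ≡ k → #V H ≤ #E H → 1 ≤ #E H → HasCycle W G
  cycle-from-counts k H #V≡k #V≤#E hasEdge
    with FP.any? (λ d → SubGraph.P? H d ×-dec (SubGraph.P? H (α d) ×-dec Face.sameOrbit? d (α d)))
  ... | yes (d , p , _ , d~αd) = loopCycle d (SubGraph.P⇒In H p) d~αd
  ... | no noLoop with FP.any? (λ r → (SubGraph.P? H r ×-dec Face.isRep? r) ×-dec (degree H r ℕ.≤? 1))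
  ...   | yes (r , (pr , isRep) , leaf) = removeLeaf k #V≡k
    where
    open RemoveLeaf H r pr isRep leaf noLoop
    removeLeaf : ∀ k → #V H ≡ k → HasCycle W G
    removeLeaf zero e = ⊥-elim (0≢1+n (trans (sym e) #V-removal))
    removeLeaf (suc k) e = cycle-from-counts k H′ (suc-injective (trans (sym #V-removal) e))
                             (#V≤#E-removal #V≤#E) (edge-removal #V≤#E hasEdge)
  ...   | no noLeaf = Walk.cycle P P⇒In continue x₀ p₀ q₀
    where
    open SubGraph H
    x₀ : Fin n
    x₀ = proj₁ (someEdge H hasEdge)
    p₀ : P x₀
    p₀ = proj₁ (proj₂ (someEdge H hasEdge))
    q₀ : P (α x₀)
    q₀ = proj₂ (proj₂ (someEdge H hasEdge))
    -- the face where x ends has degree ≥ 2, so it is left by a dual edge other than α x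
    continue : ∀ x → P x → P (α x) → Σ (Fin n) λ y → (P y × P (α y)) × SF (α x) y × y ≢ α x
    continue x p q = otherThan-αx (two-witnesses (λ d → Face.sameOrbit? r d ×-dec P? (α d)) degree≥2)
      where
      r : Fin n
      r = Face.rep (α x)
      pr : P r
      pr = P-SF (Face.rep-SO (α x)) q
      degree≥2 : 2 ≤ degree H r
      degree≥2 = ≰⇒> (λ le → noLeaf (r , (pr , Face.rep-IsRep (α x)) , le))
      leaving : ∀ y → SF r y → P (α y) → y ≢ α x → Σ (Fin n) λ y → (P y × P (α y)) × SF (α x) y × y ≢ α x
      leaving y r~y pαy y≢αx = y , (P-SF r~y pr , pαy) , Face.SO-trans (Face.rep-SO (α x)) r~y , y≢αx
      otherThan-αx : (Σ (Fin n) λ a → Σ (Fin n) λ b → a ≢ b × (SF r a × P (α a)) × (SF r b × P (α b)))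
                     → Σ (Fin n) λ y → (P y × P (α y)) × SF (α x) y × y ≢ α x
      otherThan-αx (a , b , a≢b , (r~a , pa) , (r~b , pb)) with a FP.≟ α x
      ... | yes refl = leaving b r~b pb (λ e → a≢b (sym e))
      ... | no a≢αx = leaving a r~a pa a≢αx

lemma6p5 : (W : Web) → NonElliptic W → (G : RedGraph W) → Exact W G → HasCycle W G
lemma6p5 W NE G exact = cycle-from-counts _ wholeG refl #V≤#E (≤-trans (someFace wholeG d inG-d) #V≤#E)
  where
  open RedGraphCount W G using (V≡∑; E≡∑; In-SF; exact⇒V≤E)
  open DualCycles W G
  wholeG : SubGraph
  wholeG = record { P = In W G ; P? = in? W G ; P⇒In = λ p → p ; P-SF = In-SF }
  #V≤#E : #V wholeG ≤ #E wholeG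
  #V≤#E = subst₂ _≤_ V≡∑ E≡∑ (exact⇒V≤E NE exact)
  d : Fin (Web.n W)
  d = proj₁ (RedGraph.nonempty G)
  inG-d : In W G d
  inG-d = proj₂ (RedGraph.nonempty G)
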